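{- Every antilinear permutation $\pi$ of $\mathbb{Z}_2^3$ has a unique representation of the form $\pi = L\varphi$ (composition: first $\varphi$, then $L$), where $L$ is a linear transformation of $\mathbb{Z}_2^3$ and $\varphi$ is a Fano permutation.
   Context: $\oplus$ denotes addition in $\mathbb{Z}_2^3$ and $\langle\cdot,\cdot\rangle$ the standard inner product over $\mathbb{Z}_2$; $x^\perp=\{y : \langle x,y\rangle=0\}$. A permutation $\pi$ of $\mathbb{Z}_2^3$ is antilinear if (a) $\pi(0)=0$, and (b) for all non-zero $x,y,z$, either $x\oplus y\oplus z\neq 0$ or $\pi(x)\oplus\pi(y)\oplus\pi(z)\neq0$. The signature of $\pi$ is $\sigma(x)=\bigoplus_{y\in x^\perp}\pi(y)$. An antilinear permutation is Fano if its signature is the identity map. -}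

module Defs where

open import Data.Bool using (Bool; true; false; _xor_; _∧_)
open import Data.Vec using (Vec; []; _∷_; zipWith; foldr)
open import Data.List using (List; []; _∷_; filter; map)
import Data.List as L
open import Data.Product using (Σ; _×_; _,_; ∃)
open import Relation.Binary.PropositionalEquality using (_≡_; _≢_)
open import Relation.Nullary using (¬_)
open import Data.Bool.Properties using () renaming (_≟_ to _≟B_)

-- The group Z₂³, with Z₂ modelled as Bool (false = 0, true = 1, xor = +).
V : Set
V = Vec Bool 3

𝟎 : V
𝟎 = false ∷ false ∷ false ∷ []

infixl 6 _⊕_
_⊕_ : V → V → V
_⊕_ = zipWith _xor_

⟨_,_⟩ : V → V → Bool
⟨ x , y ⟩ = foldr (λ _ → Bool) _xor_ false (zipWith _∧_ x y)

allV : List V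
allV = L.concatMap (λ a → L.concatMap (λ b → map (λ c → a ∷ b ∷ c ∷ []) (true ∷ false ∷ []))
                         (true ∷ false ∷ [])) (true ∷ false ∷ [])

perp : V → List V
perp x = filter (λ y → ⟨ x , y ⟩ ≟B false) allV

⨁ : List V → V
⨁ = L.foldr _⊕_ 𝟎

IsPermutation : (V → V) → Set
IsPermutation π = Σ (V → V) λ ρ → (∀ x → ρ (π x) ≡ x) × (∀ x → π (ρ x) ≡ x)

Antilinear : (V → V) → Set
Antilinear π = IsPermutation π × (π 𝟎 ≡ 𝟎)
  × (∀ x y z → x ≢ 𝟎 → y ≢ 𝟎 → z ≢ 𝟎 →
       ¬ ((x ⊕ y ⊕ z ≡ 𝟎) × (π x ⊕ π y ⊕ π z ≡ 𝟎)))

signature : (V → V) → V → V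
signature π x = ⨁ (map π (perp x))

Fano : (V → V) → Set
Fano φ = Antilinear φ × (∀ x → signature φ x ≡ x)

-- linear transformation of Z₂³ (additivity suffices over Z₂)
Linear : (V → V) → Set
Linear L = ∀ x y → L (x ⊕ y) ≡ L x ⊕ L y

-- The signature σ of any permutation π is linear: σ(x) ⊕ σ(y) is the sum of π over the
-- complement of (x ⊕ y)^⊥, and adding σ(x ⊕ y) gives the sum of π over all of Z₂³, which is 𝟎.
-- For antilinear π, σ also has trivial kernel, so L = σ is a linear automorphism. Then
-- φ = L⁻¹ ∘ π is antilinear with signature L⁻¹ ∘ σ = id. Conversely, for any factorisation
-- π = L′ ∘ φ′ with L′ linear and φ′ Fano, linearity gives σ = L′ ∘ σ_φ′ = L′, which forces φ′ = φ.
module Submission where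

open import Defs
open import Algebra.Bundles using (CommutativeMonoid; CommutativeRing)
open import Data.Bool using (Bool; true; false; _xor_; _∧_; not)
open import Data.Bool.Properties
  using (xor-assoc; xor-comm; xor-same; xor-annihilates-not; ∧-distribʳ-xor; xor-∧-commutativeRing)
  renaming (_≟_ to _≟B_)
open import Data.Empty using (⊥-elim)
open import Data.Fin using (Fin; zero; suc; punchOut)
open import Data.Fin.Properties using (any?; _≟_; injective⇒≤; punchOut-injective)
import Data.Fin.Permutation as Perm
open import Data.List using ([]; _∷_; filter; map)
open import Data.List.Properties using (map-cong)
import Data.Nat as ℕ
open import Data.Nat.Properties using (1+n≰n)
open import Data.Product using (Σ; ∃; _×_; _,_; proj₁; proj₂)
open import Data.Vec using (_∷_; [])
open import Data.Vec.Functional using (rearrange)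
open import Function using (_∘_)
open import Function.Definitions using (Injective)
open import Relation.Binary.PropositionalEquality
open import Relation.Nullary using (yes; no; does; contradiction)
open import Relation.Unary using (Decidable)

⊕-assoc : ∀ x y z → (x ⊕ y) ⊕ z ≡ x ⊕ (y ⊕ z)
⊕-assoc (a ∷ b ∷ c ∷ []) (d ∷ e ∷ f ∷ []) (g ∷ h ∷ i ∷ []) =
  cong₂ _∷_ (xor-assoc a d g) (cong₂ _∷_ (xor-assoc b e h) (cong₂ _∷_ (xor-assoc c f i) refl))

⊕-comm : ∀ x y → x ⊕ y ≡ y ⊕ x
⊕-comm (a ∷ b ∷ c ∷ []) (d ∷ e ∷ f ∷ []) =
  cong₂ _∷_ (xor-comm a d) (cong₂ _∷_ (xor-comm b e) (cong₂ _∷_ (xor-comm c f) refl))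

⊕-identityˡ : ∀ x → 𝟎 ⊕ x ≡ x
⊕-identityˡ (a ∷ b ∷ c ∷ []) = refl

⊕-identityʳ : ∀ x → x ⊕ 𝟎 ≡ x
⊕-identityʳ x = trans (⊕-comm x 𝟎) (⊕-identityˡ x)

⊕-self : ∀ x → x ⊕ x ≡ 𝟎
⊕-self (a ∷ b ∷ c ∷ []) =
  cong₂ _∷_ (xor-same a) (cong₂ _∷_ (xor-same b) (cong₂ _∷_ (xor-same c) refl))

⊕-commutativeMonoid : CommutativeMonoid _ _
⊕-commutativeMonoid = record
  { Carrier = V ; _≈_ = _≡_ ; _∙_ = _⊕_ ; ε = 𝟎
  ; isCommutativeMonoid = record
    { isMonoid = record
      { isSemigroup = record
        { isMagma = record { isEquivalence = isEquivalence ; ∙-cong = cong₂ _⊕_ }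
        ; assoc = ⊕-assoc }
      ; identity = ⊕-identityˡ , ⊕-identityʳ }
    ; comm = ⊕-comm } }

open import Algebra.Properties.CommutativeMonoid.Sum ⊕-commutativeMonoid
  using (sum; sum-permute; sum-cong-≗)
open import Algebra.Properties.CommutativeSemigroup
  (CommutativeMonoid.commutativeSemigroup ⊕-commutativeMonoid)
  using () renaming (interchange to ⊕-interchange)
open import Algebra.Properties.CommutativeSemigroup
  (CommutativeRing.+-commutativeSemigroup xor-∧-commutativeRing)
  using () renaming (interchange to xor-interchange)

⊕≡𝟎⇒≡ : ∀ x y → x ⊕ y ≡ 𝟎 → x ≡ y
⊕≡𝟎⇒≡ x y x⊕y≡𝟎 = begin
  x            ≡⟨ sym (⊕-identityʳ x) ⟩
  x ⊕ 𝟎        ≡⟨ cong (x ⊕_) (sym (⊕-self y)) ⟩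
  x ⊕ (y ⊕ y)  ≡⟨ sym (⊕-assoc x y y) ⟩
  (x ⊕ y) ⊕ y  ≡⟨ cong (_⊕ y) x⊕y≡𝟎 ⟩
  𝟎 ⊕ y        ≡⟨ ⊕-identityˡ y ⟩
  y            ∎
  where open ≡-Reasoning

⟨⟩-distribʳ-⊕ : ∀ x y z → ⟨ x ⊕ y , z ⟩ ≡ ⟨ x , z ⟩ xor ⟨ y , z ⟩
⟨⟩-distribʳ-⊕ (a ∷ b ∷ c ∷ []) (a′ ∷ b′ ∷ c′ ∷ []) (d ∷ e ∷ f ∷ []) = begin
  ((a xor a′) ∧ d) xor (((b xor b′) ∧ e) xor (((c xor c′) ∧ f) xor false))
    ≡⟨ cong₂ _xor_ (∧-distribʳ-xor d a a′)
         (cong₂ _xor_ (∧-distribʳ-xor e b b′) (cong (_xor false) (∧-distribʳ-xor f c c′))) ⟩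
  (p xor p′) xor ((q xor q′) xor ((r xor r′) xor (false xor false)))
    ≡⟨ cong (λ t → (p xor p′) xor t)
         (trans (cong ((q xor q′) xor_) (sym (xor-interchange r false r′ false)))
                (sym (xor-interchange q (r xor false) q′ (r′ xor false)))) ⟩
  (p xor p′) xor ((q xor (r xor false)) xor (q′ xor (r′ xor false)))
    ≡⟨ sym (xor-interchange p _ p′ _) ⟩
  (p xor (q xor (r xor false))) xor (p′ xor (q′ xor (r′ xor false))) ∎
  where
  open ≡-Reasoning
  p p′ q q′ r r′ : Bool
  p = a ∧ d ; p′ = a′ ∧ d ; q = b ∧ e ; q′ = b′ ∧ e ; r = c ∧ f ; r′ = c′ ∧ f

pattern v111 = true ∷ true ∷ true ∷ []
pattern v110 = true ∷ true ∷ false ∷ []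
pattern v101 = true ∷ false ∷ true ∷ []
pattern v100 = true ∷ false ∷ false ∷ []
pattern v011 = false ∷ true ∷ true ∷ []
pattern v010 = false ∷ true ∷ false ∷ []
pattern v001 = false ∷ false ∷ true ∷ []
pattern v000 = false ∷ false ∷ false ∷ []

-- Numbering of V in the order of allV, so that sums over allV are sums over Fin 8.
index : V → Fin 8
index v111 = zero
index v110 = suc zero
index v101 = suc (suc zero)
index v100 = suc (suc (suc zero))
index v011 = suc (suc (suc (suc zero)))
index v010 = suc (suc (suc (suc (suc zero))))
index v001 = suc (suc (suc (suc (suc (suc zero)))))
index v000 = suc (suc (suc (suc (suc (suc (suc zero))))))

element : Fin 8 → V
element zero = v111
element (suc zero) = v110
element (suc (suc zero)) = v101
element (suc (suc (suc zero))) = v100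
element (suc (suc (suc (suc zero)))) = v011
element (suc (suc (suc (suc (suc zero))))) = v010
element (suc (suc (suc (suc (suc (suc zero)))))) = v001
element (suc (suc (suc (suc (suc (suc (suc zero))))))) = v000

element-index : ∀ v → element (index v) ≡ v
element-index v111 = refl
element-index v110 = refl
element-index v101 = refl
element-index v100 = refl
element-index v011 = refl
element-index v010 = refl
element-index v001 = refl
element-index v000 = refl

index-element : ∀ i → index (element i) ≡ i
index-element zero = refl
index-element (suc zero) = refl
index-element (suc (suc zero)) = refl
index-element (suc (suc (suc zero))) = refl
index-element (suc (suc (suc (suc zero)))) = refl
index-element (suc (suc (suc (suc (suc zero))))) = refl
index-element (suc (suc (suc (suc (suc (suc zero)))))) = refl
index-element (suc (suc (suc (suc (suc (suc (suc zero))))))) = refl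

index-injective : Injective _≡_ _≡_ index
index-injective {x} {y} eq = begin
  x                  ≡⟨ sym (element-index x) ⟩
  element (index x)  ≡⟨ cong element eq ⟩
  element (index y)  ≡⟨ element-index y ⟩
  y                  ∎
  where open ≡-Reasoning

⨁-permutation : (π : V → V) → IsPermutation π → ⨁ (map π allV) ≡ 𝟎
⨁-permutation π (ρ , ρπ , πρ) = begin
  sum (π ∘ element)                            ≡⟨ sum-cong-≗ (λ i → sym (element-index (π (element i)))) ⟩
  sum (rearrange (P Perm.⟨$⟩ʳ_) element)       ≡⟨ sym (sum-permute element P) ⟩
  ⨁ allV                                       ≡⟨⟩
  𝟎                                            ∎
  where
  open ≡-Reasoning
  onIndices : (V → V) → Fin 8 → Fin 8
  onIndices f = index ∘ f ∘ element
  inverse : ∀ f g → (∀ x → f (g x) ≡ x) → ∀ i → onIndices f (onIndices g i) ≡ i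
  inverse f g fg i = begin
    index (f (element (index (g (element i))))) ≡⟨ cong (index ∘ f) (element-index _) ⟩
    index (f (g (element i)))                   ≡⟨ cong index (fg (element i)) ⟩
    index (element i)                           ≡⟨ index-element i ⟩
    i                                           ∎
  P : Perm.Permutation 8 8
  P = Perm.permutation (onIndices π) (onIndices ρ) (inverse π ρ πρ) (inverse ρ π ρπ)

⨁-filter-xor : (f : V → V) {P Q R : V → Set} (P? : Decidable P) (Q? : Decidable Q) (R? : Decidable R) →
  (∀ z → does (P? z) xor does (Q? z) ≡ does (R? z)) → ∀ l →
  ⨁ (map f (filter P? l)) ⊕ ⨁ (map f (filter Q? l)) ≡ ⨁ (map f (filter R? l))
⨁-filter-xor f P? Q? R? PΔQ≡R [] = refl
⨁-filter-xor f P? Q? R? PΔQ≡R (z ∷ l)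
  with does (P? z) | does (Q? z) | does (R? z) | PΔQ≡R z | ⨁-filter-xor f P? Q? R? PΔQ≡R l
... | false | false | false | _ | ih = ih
... | true  | false | true  | _ | ih = trans (⊕-assoc (f z) _ _) (cong (f z ⊕_) ih)
... | false | true  | true  | _ | ih = begin
  p ⊕ (f z ⊕ q)  ≡⟨ sym (⊕-assoc p (f z) q) ⟩
  p ⊕ f z ⊕ q    ≡⟨ cong (_⊕ q) (⊕-comm p (f z)) ⟩
  f z ⊕ p ⊕ q    ≡⟨ ⊕-assoc (f z) p q ⟩
  f z ⊕ (p ⊕ q)  ≡⟨ cong (f z ⊕_) ih ⟩
  _              ∎
  where
  open ≡-Reasoning
  p q : V
  p = ⨁ (map f (filter P? l)) ; q = ⨁ (map f (filter Q? l))
... | true  | true  | false | _ | ih = begin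
  (f z ⊕ p) ⊕ (f z ⊕ q)  ≡⟨ ⊕-interchange (f z) p (f z) q ⟩
  (f z ⊕ f z) ⊕ (p ⊕ q)  ≡⟨ cong (_⊕ (p ⊕ q)) (⊕-self (f z)) ⟩
  𝟎 ⊕ (p ⊕ q)            ≡⟨ ⊕-identityˡ (p ⊕ q) ⟩
  p ⊕ q                  ≡⟨ ih ⟩
  _                      ∎
  where
  open ≡-Reasoning
  p q : V
  p = ⨁ (map f (filter P? l)) ; q = ⨁ (map f (filter Q? l))
... | false | false | true  | () | _
... | true  | false | false | () | _
... | false | true  | false | () | _
... | true  | true  | true  | () | _

does-≟false : ∀ b → does (b ≟B false) ≡ not b
does-≟false true = refl
does-≟false false = refl

does-≟true : ∀ b → does (b ≟B true) ≡ b
does-≟true true = refl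
does-≟true false = refl

cosignature : (V → V) → V → V
cosignature π x = ⨁ (map π (filter (λ z → ⟨ x , z ⟩ ≟B true) allV))

signature-⊕-cosignature : ∀ π x → signature π x ⊕ cosignature π x ≡ ⨁ (map π allV)
signature-⊕-cosignature π x =
  ⨁-filter-xor π (λ z → ⟨ x , z ⟩ ≟B false) (λ z → ⟨ x , z ⟩ ≟B true) (λ _ → true ≟B true)
    (λ z → trans (cong₂ _xor_ (does-≟false ⟨ x , z ⟩) (does-≟true ⟨ x , z ⟩)) (not-xor-self ⟨ x , z ⟩))
    allV
  where
  not-xor-self : ∀ b → not b xor b ≡ true
  not-xor-self true = refl
  not-xor-self false = refl

signature-⊕ : ∀ π x y → signature π x ⊕ signature π y ≡ cosignature π (x ⊕ y)
signature-⊕ π x y =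
  ⨁-filter-xor π (λ z → ⟨ x , z ⟩ ≟B false) (λ z → ⟨ y , z ⟩ ≟B false) (λ z → ⟨ x ⊕ y , z ⟩ ≟B true)
    orthogonality allV
  where
  orthogonality : ∀ z → does (⟨ x , z ⟩ ≟B false) xor does (⟨ y , z ⟩ ≟B false) ≡ does (⟨ x ⊕ y , z ⟩ ≟B true)
  orthogonality z = begin
    does (⟨ x , z ⟩ ≟B false) xor does (⟨ y , z ⟩ ≟B false)
      ≡⟨ cong₂ _xor_ (does-≟false ⟨ x , z ⟩) (does-≟false ⟨ y , z ⟩) ⟩
    not ⟨ x , z ⟩ xor not ⟨ y , z ⟩  ≡⟨ xor-annihilates-not ⟨ x , z ⟩ ⟨ y , z ⟩ ⟩
    ⟨ x , z ⟩ xor ⟨ y , z ⟩          ≡⟨ sym (⟨⟩-distribʳ-⊕ x y z) ⟩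
    ⟨ x ⊕ y , z ⟩                    ≡⟨ sym (does-≟true ⟨ x ⊕ y , z ⟩) ⟩
    does (⟨ x ⊕ y , z ⟩ ≟B true)     ∎
    where open ≡-Reasoning

signature-linear : ∀ π → IsPermutation π → Linear (signature π)
signature-linear π perm x y = ⊕≡𝟎⇒≡ (signature π (x ⊕ y)) (signature π x ⊕ signature π y) (begin
  signature π (x ⊕ y) ⊕ (signature π x ⊕ signature π y)  ≡⟨ cong (signature π (x ⊕ y) ⊕_) (signature-⊕ π x y) ⟩
  signature π (x ⊕ y) ⊕ cosignature π (x ⊕ y)            ≡⟨ signature-⊕-cosignature π (x ⊕ y) ⟩
  ⨁ (map π allV)                                         ≡⟨ ⨁-permutation π perm ⟩
  𝟎                                                      ∎)
  where open ≡-Reasoning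

-- For x ≠ 𝟎, x^⊥ consists of 𝟎 and a line {a, b, c} with a ⊕ b ⊕ c = 𝟎, so σ(x) = π a ⊕ π b ⊕ π c.
signature-kernel : ∀ π → Antilinear π → ∀ x → signature π x ≡ 𝟎 → x ≡ 𝟎
signature-kernel π (_ , π𝟎≡𝟎 , antilinear) = λ where
    v111 → line v110 v101 v011 (λ ()) (λ ()) (λ ()) refl
    v110 → line v111 v110 v001 (λ ()) (λ ()) (λ ()) refl
    v101 → line v111 v101 v010 (λ ()) (λ ()) (λ ()) refl
    v100 → line v011 v010 v001 (λ ()) (λ ()) (λ ()) refl
    v011 → line v111 v100 v011 (λ ()) (λ ()) (λ ()) refl
    v010 → line v101 v100 v001 (λ ()) (λ ()) (λ ()) refl
    v001 → line v110 v100 v010 (λ ()) (λ ()) (λ ()) refl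
    v000 _ → refl
  where
  line : ∀ a b c {x} → a ≢ 𝟎 → b ≢ 𝟎 → c ≢ 𝟎 → a ⊕ b ⊕ c ≡ 𝟎 →
         π a ⊕ (π b ⊕ (π c ⊕ (π 𝟎 ⊕ 𝟎))) ≡ 𝟎 → x ≡ 𝟎
  line a b c a≢𝟎 b≢𝟎 c≢𝟎 a⊕b⊕c≡𝟎 σ≡𝟎 = ⊥-elim (antilinear a b c a≢𝟎 b≢𝟎 c≢𝟎 (a⊕b⊕c≡𝟎 , (begin
    π a ⊕ π b ⊕ π c                  ≡⟨ ⊕-assoc (π a) (π b) (π c) ⟩
    π a ⊕ (π b ⊕ π c)                ≡⟨ cong (λ t → π a ⊕ (π b ⊕ t)) (sym (⊕-identityʳ (π c))) ⟩
    π a ⊕ (π b ⊕ (π c ⊕ 𝟎))          ≡⟨ cong (λ t → π a ⊕ (π b ⊕ (π c ⊕ (t ⊕ 𝟎)))) (sym π𝟎≡𝟎) ⟩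
    π a ⊕ (π b ⊕ (π c ⊕ (π 𝟎 ⊕ 𝟎)))  ≡⟨ σ≡𝟎 ⟩
    𝟎                                ∎)))
    where open ≡-Reasoning

-- A value y outside the image would make punchOut y ∘ f an injection Fin (1+n) → Fin n.
Fin-injective⇒surjective : ∀ {n} (f : Fin n → Fin n) → Injective _≡_ _≡_ f → ∀ y → ∃ λ x → f x ≡ y
Fin-injective⇒surjective {ℕ.zero} _ _ ()
Fin-injective⇒surjective {ℕ.suc n} f f-injective y with any? (λ x → f x ≟ y)
... | yes hit = hit
... | no miss = contradiction (injective⇒≤ punched-injective) 1+n≰n
  where
  y∉image : ∀ x → y ≢ f x
  y∉image x y≡fx = miss (x , sym y≡fx)
  punched : Fin (ℕ.suc n) → Fin n
  punched x = punchOut (y∉image x)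
  punched-injective : Injective _≡_ _≡_ punched
  punched-injective {x} {x′} eq = f-injective (punchOut-injective (y∉image x) (y∉image x′) eq)

injective⇒surjective : ∀ {f : V → V} → Injective _≡_ _≡_ f → ∀ y → ∃ λ x → f x ≡ y
injective⇒surjective {f} f-injective y =
  let i , hit = Fin-injective⇒surjective (index ∘ f ∘ element) onIndices-injective (index y)
  in element i , index-injective hit
  where
  onIndices-injective : Injective _≡_ _≡_ (index ∘ f ∘ element)
  onIndices-injective {i} {j} eq = begin
    i                  ≡⟨ sym (index-element i) ⟩
    index (element i)  ≡⟨ cong index (f-injective (index-injective eq)) ⟩
    index (element j)  ≡⟨ index-element j ⟩
    j                  ∎
    where open ≡-Reasoning

linear-𝟎 : ∀ {L} → Linear L → L 𝟎 ≡ 𝟎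
linear-𝟎 {L} L-linear = trans (L-linear 𝟎 𝟎) (⊕-self (L 𝟎))

linear-⊕₃ : ∀ {L} → Linear L → ∀ x y z → L (x ⊕ y ⊕ z) ≡ L x ⊕ L y ⊕ L z
linear-⊕₃ {L} L-linear x y z = trans (L-linear (x ⊕ y) z) (cong (_⊕ L z) (L-linear x y))

linear-injective : ∀ {L} → Linear L → (∀ x → L x ≡ 𝟎 → x ≡ 𝟎) → Injective _≡_ _≡_ L
linear-injective {L} L-linear kernel {x} {y} Lx≡Ly = ⊕≡𝟎⇒≡ x y (kernel (x ⊕ y) (begin
  L (x ⊕ y)    ≡⟨ L-linear x y ⟩
  L x ⊕ L y    ≡⟨ cong (_⊕ L y) Lx≡Ly ⟩
  L y ⊕ L y    ≡⟨ ⊕-self (L y) ⟩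
  𝟎            ∎))
  where open ≡-Reasoning

record LinearInverse (L : V → V) : Set where
  field
    L⁻¹ : V → V
    L⁻¹-linear : Linear L⁻¹
    L⁻¹∘L : ∀ x → L⁻¹ (L x) ≡ x
    L∘L⁻¹ : ∀ y → L (L⁻¹ y) ≡ y

linear-inverse : ∀ {L} → Linear L → (∀ x → L x ≡ 𝟎 → x ≡ 𝟎) → LinearInverse L
linear-inverse {L} L-linear kernel = record
  { L⁻¹ = L⁻¹ ; L⁻¹-linear = L⁻¹-linear ; L⁻¹∘L = L⁻¹∘L ; L∘L⁻¹ = L∘L⁻¹ }
  where
  L-injective : Injective _≡_ _≡_ L
  L-injective = linear-injective L-linear kernel
  L⁻¹ : V → V
  L⁻¹ y = proj₁ (injective⇒surjective L-injective y)
  L∘L⁻¹ : ∀ y → L (L⁻¹ y) ≡ y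
  L∘L⁻¹ y = proj₂ (injective⇒surjective L-injective y)
  L⁻¹∘L : ∀ x → L⁻¹ (L x) ≡ x
  L⁻¹∘L x = L-injective (L∘L⁻¹ (L x))
  L⁻¹-linear : Linear L⁻¹
  L⁻¹-linear x y = L-injective (begin
    L (L⁻¹ (x ⊕ y))          ≡⟨ L∘L⁻¹ (x ⊕ y) ⟩
    x ⊕ y                    ≡⟨ sym (cong₂ _⊕_ (L∘L⁻¹ x) (L∘L⁻¹ y)) ⟩
    L (L⁻¹ x) ⊕ L (L⁻¹ y)    ≡⟨ sym (L-linear (L⁻¹ x) (L⁻¹ y)) ⟩
    L (L⁻¹ x ⊕ L⁻¹ y)        ∎)
    where open ≡-Reasoning

∘-isPermutation : ∀ {f g} → IsPermutation f → IsPermutation g → IsPermutation (f ∘ g)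
∘-isPermutation {f} {g} (f⁻¹ , f⁻¹∘f , f∘f⁻¹) (g⁻¹ , g⁻¹∘g , g∘g⁻¹) =
  g⁻¹ ∘ f⁻¹ ,
  (λ x → trans (cong g⁻¹ (f⁻¹∘f (g x))) (g⁻¹∘g x)) ,
  (λ y → trans (cong f (g∘g⁻¹ (f⁻¹ y))) (f∘f⁻¹ y))

linear-∘-antilinear : ∀ {M π} → Linear M → IsPermutation M → Antilinear π → Antilinear (M ∘ π)
linear-∘-antilinear {M} {π} M-linear M-perm@(M⁻¹ , M⁻¹∘M , _) (π-perm , π𝟎≡𝟎 , antilinear) =
  ∘-isPermutation M-perm π-perm ,
  trans (cong M π𝟎≡𝟎) (linear-𝟎 M-linear) ,
  λ x y z x≢𝟎 y≢𝟎 z≢𝟎 (x⊕y⊕z≡𝟎 , Mπ-sum≡𝟎) → antilinear x y z x≢𝟎 y≢𝟎 z≢𝟎 (x⊕y⊕z≡𝟎 , (begin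
    π x ⊕ π y ⊕ π z                    ≡⟨ sym (M⁻¹∘M _) ⟩
    M⁻¹ (M (π x ⊕ π y ⊕ π z))          ≡⟨ cong M⁻¹ (linear-⊕₃ M-linear (π x) (π y) (π z)) ⟩
    M⁻¹ (M (π x) ⊕ M (π y) ⊕ M (π z))  ≡⟨ cong M⁻¹ Mπ-sum≡𝟎 ⟩
    M⁻¹ 𝟎                              ≡⟨ cong M⁻¹ (sym (linear-𝟎 M-linear)) ⟩
    M⁻¹ (M 𝟎)                          ≡⟨ M⁻¹∘M 𝟎 ⟩
    𝟎                                  ∎))
  where open ≡-Reasoning

⨁-map-linear : ∀ {M} → Linear M → (f : V → V) → ∀ l → ⨁ (map (M ∘ f) l) ≡ M (⨁ (map f l))
⨁-map-linear M-linear f [] = sym (linear-𝟎 M-linear)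
⨁-map-linear {M} M-linear f (z ∷ l) =
  trans (cong (M (f z) ⊕_) (⨁-map-linear M-linear f l)) (sym (M-linear (f z) _))

signature-linear-∘ : ∀ {M} → Linear M → ∀ π x → signature (M ∘ π) x ≡ M (signature π x)
signature-linear-∘ M-linear π x = ⨁-map-linear M-linear π (perp x)

signature-cong : ∀ {π π′} → (∀ x → π x ≡ π′ x) → ∀ x → signature π x ≡ signature π′ x
signature-cong π≗π′ x = cong ⨁ (map-cong π≗π′ (perp x))

signature-invertible : ∀ π → Antilinear π → LinearInverse (signature π)
signature-invertible π π-antilinear@(π-perm , _) =
  linear-inverse (signature-linear π π-perm) (signature-kernel π π-antilinear)

factor-signature : ∀ {π L φ} → Linear L → Fano φ → (∀ x → π x ≡ L (φ x)) → ∀ x → L x ≡ signature π x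
factor-signature {π} {L} {φ} L-linear (_ , σφ≡id) π≡L∘φ x = begin
  L x                  ≡⟨ cong L (sym (σφ≡id x)) ⟩
  L (signature φ x)    ≡⟨ sym (signature-linear-∘ L-linear φ x) ⟩
  signature (L ∘ φ) x  ≡⟨ sym (signature-cong π≡L∘φ x) ⟩
  signature π x        ∎
  where open ≡-Reasoning

lemma4 : (π : V → V) → Antilinear π →
    Σ (V → V) λ L → Σ (V → V) λ φ →
      (Linear L × Fano φ × (∀ x → π x ≡ L (φ x)))
      × ((L′ φ′ : V → V) → Linear L′ → Fano φ′ → (∀ x → π x ≡ L′ (φ′ x)) →
           (∀ x → L′ x ≡ L x) × (∀ x → φ′ x ≡ φ x))
lemma4 π π-antilinear@(π-perm , _) =
  L , L⁻¹ ∘ π , (L-linear , φ-fano , λ x → sym (L∘L⁻¹ (π x))) , unique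
  where
  L : V → V
  L = signature π
  L-linear : Linear L
  L-linear = signature-linear π π-perm
  open LinearInverse (signature-invertible π π-antilinear)
  φ-fano : Fano (L⁻¹ ∘ π)
  φ-fano = linear-∘-antilinear L⁻¹-linear (L , L∘L⁻¹ , L⁻¹∘L) π-antilinear ,
           λ x → trans (signature-linear-∘ L⁻¹-linear π x) (L⁻¹∘L x)
  unique : (L′ φ′ : V → V) → Linear L′ → Fano φ′ → (∀ x → π x ≡ L′ (φ′ x)) →
           (∀ x → L′ x ≡ L x) × (∀ x → φ′ x ≡ L⁻¹ (π x))
  unique L′ φ′ L′-linear φ′-fano π≡L′∘φ′ =
    L′≡L , λ x → trans (sym (L⁻¹∘L (φ′ x))) (cong L⁻¹ (trans (sym (L′≡L (φ′ x))) (sym (π≡L′∘φ′ x))))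
    where
    L′≡L : ∀ x → L′ x ≡ L x
    L′≡L = factor-signature L′-linear φ′-fano π≡L′∘φ′
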